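{- Let $\widehat{\mathcal M}$ be an extension (by an element $q$) of a P-matroid on the ground set $S\cup T$ with $S=\{s_1,\dots,s_n\}$, $T=\{t_1,\dots,t_n\}$, and let $O$ be the partial P-matroid USO obtained from $\widehat{\mathcal M}$. Then $O$ is partially Szab\'o-Welzl: for any two distinct vertices $v,w\in\{0,1\}^n$, either $O(v)_i=O(w)_i=0$ for all $i$ with $v_i\neq w_i$, or there exists $i$ with $v_i\neq w_i$ and $\{O(v)_i,O(w)_i\}=\{ -,+\}$.
   Context: A signed set on a finite set $E$ is a vector $X\in\{ -,0,+\}^E$; $X^+=\{e:X_e=+\}$, $X^-=\{e:X_e=-\}$, $\underline{X}=X^+\cup X^-$ (support), and $-X$ flips all signs. An oriented matroid $\mathcal M=(E,\mathcal C)$ is given by a collection $\mathcal C$ of signed sets (circuits) satisfying: (C0) the zero vector is not in $\mathcal C$; (C1) $X\in\mathcal C\iff -X\in\mathcal C$; (C2) if $X,Y\in\mathcal C$ and $\underline X\subseteq\underline Y$ then $X=\pm Y$; (C3) for $X,Y\in\mathcal C$, $X\neq -Y$, $e\in X^+\cap Y^-$ there is $Z\in\mathcal C$ with $Z^+\subseteq (X^+\cup Y^+)\setminus\{e\}$ and $Z^-\subseteq(X^-\cup Y^-)\setminus\{e\}$. A basis is an inclusion-maximal subset of $E$ containing the support of no circuit. For a basis $B$ and $e\notin B$, the fundamental circuit $C(B,e)$ is the unique circuit $X$ with $X_e=+$ and $\underline X\subseteq B\cup\{e\}$. Let $E_{2n}=S\cup T$ with $S=\{s_1,\dots,s_n\}$,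 $T=\{t_1,\dots,t_n\}$ disjoint; a set is complementary if it contains no pair $\{s_i,t_i\}$. An oriented matroid on $E_{2n}$ is a P-matroid if $S$ is a basis and no circuit $X$ is sign-reversing, where $X$ is sign-reversing if $X_{s_i}=-X_{t_i}$ for every $i$ with $\{s_i,t_i\}\subseteq\underline X$. An extension of $\mathcal M=(E_{2n},\mathcal C)$ is an oriented matroid $\widehat{\mathcal M}=(E_{2n}\cup\{q\},\widehat{\mathcal C})$, $q\notin E_{2n}$, whose circuits with $X_q=0$ (restricted to $E_{2n}$) are exactly $\mathcal C$. It is known that in an extension of a P-matroid every complementary subset of $S\cup T$ of size $n$ is a basis. For $v\in\{0,1\}^n$ let $B(v)$ contain $s_i$ if $v_i=0$ and $t_i$ if $v_i=1$. The partial P-matroid USO (PPU) of $\widehat{\mathcal M}$ is the map $O\colon\{0,1\}^n\to\{ -,0,+\}^n$ defined with $C:=C(B(v),q)$ by $O(v)_i=+$ if $C_{s_i}=-$ or $C_{t_i}=-$; $O(v)_i=-$ if $C_{s_i}=+$ or $C_{t_i}=+$; and $O(v)_i=0$ if $C_{s_i}=C_{t_i}=0$. Here $O(v)_i$ describes the half-edge at vertex $v$ of the $n$-cube in dimension $i$ ($+$ outgoing, $-$ incoming, $0$ unoriented). -}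

module Defs where

open import Data.Nat using (ℕ)
open import Data.Fin using (Fin)
open import Data.Bool using (Bool; true; false)
open import Data.Vec using (Vec; lookup)
open import Data.Product using (Σ; _×_; _,_)
open import Data.Sum using (_⊎_)
open import Data.Empty using (⊥)
open import Relation.Nullary using (¬_)
open import Relation.Binary.PropositionalEquality using (_≡_; _≢_)

data Sign : Set where
  ⊖ ⊙ ⊕ : Sign

negS : Sign → Sign
negS ⊖ = ⊕
negS ⊙ = ⊙
negS ⊕ = ⊖

SignedSet : Set → Set
SignedSet E = E → Sign

zeroSS : {E : Set} → SignedSet E
zeroSS _ = ⊙

negSS : {E : Set} → SignedSet E → SignedSet E
negSS X e = negS (X e)

_≐_ : {E : Set} → SignedSet E → SignedSet E → Set
X ≐ Y = ∀ e → X e ≡ Y e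

_⊆ₛ_ : {E : Set} → SignedSet E → SignedSet E → Set
X ⊆ₛ Y = ∀ e → X e ≢ ⊙ → Y e ≢ ⊙

record OrientedMatroid (E : Set) : Set₁ where
  field
    Circuit : SignedSet E → Set
    -- the collection is a set of vectors (closed under pointwise equality)
    resp : ∀ {X Y} → X ≐ Y → Circuit X → Circuit Y
    C0 : ¬ Circuit zeroSS
    C1 : ∀ X → Circuit X → Circuit (negSS X)
    C1' : ∀ X → Circuit (negSS X) → Circuit X
    C2 : ∀ X Y → Circuit X → Circuit Y → X ⊆ₛ Y → (X ≐ Y) ⊎ (X ≐ negSS Y)
    C3 : ∀ X Y → Circuit X → Circuit Y → ¬ (X ≐ negSS Y) →
         ∀ e → X e ≡ ⊕ → Y e ≡ ⊖ →
         Σ (SignedSet E) λ Z → Circuit Z ×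
           (∀ f → Z f ≡ ⊕ → (X f ≡ ⊕ ⊎ Y f ≡ ⊕) × f ≢ e) ×
           (∀ f → Z f ≡ ⊖ → (X f ≡ ⊖ ⊎ Y f ≡ ⊖) × f ≢ e)

open OrientedMatroid public

Subset : Set → Set
Subset E = E → Bool

_⊆_ : {E : Set} → Subset E → Subset E → Set
A ⊆ B = ∀ e → A e ≡ true → B e ≡ true

SuppIn : {E : Set} → SignedSet E → Subset E → Set
SuppIn X B = ∀ e → X e ≢ ⊙ → B e ≡ true

Independent : {E : Set} → OrientedMatroid E → Subset E → Set
Independent M B = ∀ X → Circuit M X → ¬ SuppIn X B

IsBasis : {E : Set} → OrientedMatroid E → Subset E → Set
IsBasis M B = Independent M B × (∀ B' → Independent M B' → B ⊆ B' → B' ⊆ B)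

data E2 (n : ℕ) : Set where
  s : Fin n → E2 n
  t : Fin n → E2 n

data Ext (E : Set) : Set where
  q  : Ext E
  el : E → Ext E

Sset : (n : ℕ) → Subset (E2 n)
Sset n (s _) = true
Sset n (t _) = false

SignReversing : {n : ℕ} → SignedSet (E2 n) → Set
SignReversing {n} X = ∀ (i : Fin n) → X (s i) ≢ ⊙ → X (t i) ≢ ⊙ → X (s i) ≡ negS (X (t i))

IsPMatroid : {n : ℕ} → OrientedMatroid (E2 n) → Set
IsPMatroid {n} M = IsBasis M (Sset n) × (∀ X → Circuit M X → ¬ SignReversing X)

ext0 : {E : Set} → SignedSet E → SignedSet (Ext E)
ext0 X q = ⊙
ext0 X (el e) = X e

-- circuits of Mhat with X_q = 0, restricted to E, are exactly the circuits of M
-- (since Circuit Mhat respects pointwise equality, this covers every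
--  circuit of Mhat with X_q = 0)
IsExtension : {E : Set} → OrientedMatroid E → OrientedMatroid (Ext E) → Set
IsExtension {E} M Mh = ∀ (X : SignedSet E) → (Circuit M X → Circuit Mh (ext0 X)) × (Circuit Mh (ext0 X) → Circuit M X)

-- B(v) ∪ {q}, with v ∈ {0,1}^n encoded as Vec Bool n (false = 0, true = 1)
Bq : {n : ℕ} → Vec Bool n → Subset (Ext (E2 n))
Bq v q = true
Bq v (el (s i)) with lookup v i
... | false = true
... | true  = false
Bq v (el (t i)) = lookup v i

Bv : {n : ℕ} → Vec Bool n → Subset (E2 n)
Bv v e = Bq v (el e)

ppuSign : Sign → Sign → Sign
ppuSign ⊖ _ = ⊕
ppuSign _ ⊖ = ⊕
ppuSign ⊕ _ = ⊖
ppuSign _ ⊕ = ⊖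
ppuSign ⊙ ⊙ = ⊙

IsFundCircuit : {n : ℕ} → OrientedMatroid (Ext (E2 n)) → Vec Bool n → SignedSet (Ext (E2 n)) → Set
IsFundCircuit Mh v X = Circuit Mh X × X q ≡ ⊕ × SuppIn X (Bq v)

IsPPU : {n : ℕ} → OrientedMatroid (Ext (E2 n)) → (Vec Bool n → Fin n → Sign) → Set
IsPPU {n} Mh O = ∀ (v : Vec Bool n) → Σ (SignedSet (Ext (E2 n))) λ X →
  IsFundCircuit Mh v X × (∀ i → O v i ≡ ppuSign (X (el (s i))) (X (el (t i))))

PartiallySW : {n : ℕ} → (Vec Bool n → Fin n → Sign) → Set
PartiallySW {n} O = ∀ (v w : Vec Bool n) → v ≢ w →
  (∀ i → lookup v i ≢ lookup w i → O v i ≡ ⊙ × O w i ≡ ⊙)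
  ⊎ Σ (Fin n) λ i → lookup v i ≢ lookup w i ×
      ((O v i ≡ ⊖ × O w i ≡ ⊕) ⊎ (O v i ≡ ⊕ × O w i ≡ ⊖))

{-# OPTIONS --safe #-}
-- Let X = C(B(v),q) and Y = C(B(w),q). On a coordinate i where v and w
-- differ, one of s_i, t_i lies outside B(v) and the other outside B(w). So if
-- X = Y, then X vanishes on the pair and O(v)_i = O(w)_i = 0. Otherwise
-- eliminating q between X and −Y yields a circuit Z of the P-matroid. Z is
-- zero on pairs where v and w agree, and on a pair where they differ it
-- equals X on one element and −Y on the other; if no coordinate had opposite
-- orientations, X and Y would carry the same sign there, making Z
-- sign-reversing, which a P-matroid forbids.
module Submission where

open import Defs
open import Data.Nat using (ℕ)
open import Data.Fin using (Fin)
open import Data.Fin.Properties using (any?)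
open import Data.Bool using (Bool; true; false; not)
open import Data.Bool.Properties using (not-involutive; ¬-not; not-¬) renaming (_≟_ to _≟ᵇ_)
open import Data.Vec using (Vec; lookup)
open import Data.Product using (Σ; _×_; _,_; proj₁; proj₂)
open import Data.Sum using (_⊎_; inj₁; inj₂; swap)
open import Data.Empty using (⊥-elim)
open import Function using (_∘_)
open import Relation.Nullary using (¬_; Dec; yes; no)
open import Relation.Nullary.Decidable using (_×-dec_; _⊎-dec_; ¬?; decidable-stable)
open import Relation.Binary.PropositionalEquality
  using (_≡_; _≢_; refl; sym; trans; cong; subst; subst₂)

_≟_ : (a b : Sign) → Dec (a ≡ b)
⊖ ≟ ⊖ = yes refl
⊖ ≟ ⊙ = no λ ()
⊖ ≟ ⊕ = no λ ()
⊙ ≟ ⊖ = no λ ()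
⊙ ≟ ⊙ = yes refl
⊙ ≟ ⊕ = no λ ()
⊕ ≟ ⊖ = no λ ()
⊕ ≟ ⊙ = no λ ()
⊕ ≟ ⊕ = yes refl

negS-involutive : ∀ x → negS (negS x) ≡ x
negS-involutive ⊖ = refl
negS-involutive ⊙ = refl
negS-involutive ⊕ = refl

negS-swap : ∀ {x y} → x ≡ negS y → y ≡ negS x
negS-swap {y = y} refl = sym (negS-involutive y)

Opposite : Sign → Sign → Set
Opposite a b = (a ≡ ⊖ × b ≡ ⊕) ⊎ (a ≡ ⊕ × b ≡ ⊖)

opposite? : ∀ a b → Dec (Opposite a b)
opposite? a b = ((a ≟ ⊖) ×-dec (b ≟ ⊕)) ⊎-dec ((a ≟ ⊕) ×-dec (b ≟ ⊖))

ppuSign-⊙ʳ : ∀ x → ppuSign x ⊙ ≡ negS x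
ppuSign-⊙ʳ ⊖ = refl
ppuSign-⊙ʳ ⊙ = refl
ppuSign-⊙ʳ ⊕ = refl

ppuSign-⊙ˡ : ∀ y → ppuSign ⊙ y ≡ negS y
ppuSign-⊙ˡ ⊖ = refl
ppuSign-⊙ˡ ⊙ = refl
ppuSign-⊙ˡ ⊕ = refl

eliminant-sign : ∀ {z a b} → z ≢ ⊙ →
  (z ≡ ⊕ → a ≡ ⊕ ⊎ b ≡ ⊕) → (z ≡ ⊖ → a ≡ ⊖ ⊎ b ≡ ⊖) → b ≡ ⊙ → z ≡ a
eliminant-sign {⊙} z≢⊙ _ _ _ = ⊥-elim (z≢⊙ refl)
eliminant-sign {⊕} _ plus _ refl with plus refl
... | inj₁ a≡⊕ = sym a≡⊕
... | inj₂ ()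
eliminant-sign {⊖} _ _ minus refl with minus refl
... | inj₁ a≡⊖ = sym a≡⊖
... | inj₂ ()

reversed-unless-opposite : ∀ {zx zy x y} → zx ≢ ⊙ → zy ≢ ⊙ →
  zx ≡ x → zy ≡ negS y → ¬ Opposite (negS x) (negS y) → zx ≡ negS zy
reversed-unless-opposite {⊙} zx≢⊙ _ _ _ _ = ⊥-elim (zx≢⊙ refl)
reversed-unless-opposite {zy = ⊙} _ zy≢⊙ _ _ _ = ⊥-elim (zy≢⊙ refl)
reversed-unless-opposite {⊕} {⊖} {y = ⊕} _ _ refl refl _ = refl
reversed-unless-opposite {⊖} {⊕} {y = ⊖} _ _ refl refl _ = refl
reversed-unless-opposite {⊕} {⊕} {y = ⊖} _ _ refl refl ¬opp = ⊥-elim (¬opp (inj₁ (refl , refl)))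
reversed-unless-opposite {⊖} {⊖} {y = ⊕} _ _ refl refl ¬opp = ⊥-elim (¬opp (inj₂ (refl , refl)))

≢-negSS-negSS : ∀ {E} {X Y : SignedSet E} → ¬ X ≐ Y → ¬ X ≐ negSS (negSS Y)
≢-negSS-negSS {Y = Y} X≢Y X≐Y″ = X≢Y λ f → trans (X≐Y″ f) (negS-involutive (Y f))

module _ {E : Set} (M : OrientedMatroid E) where

  record Elimination (X Y : SignedSet E) (e : E) : Set where
    field
      eliminant   : SignedSet E
      circuit     : Circuit M eliminant
      avoids      : eliminant e ≡ ⊙
      agrees-X    : ∀ f → Y f ≡ ⊙ → eliminant f ≢ ⊙ → eliminant f ≡ X f
      agrees-negY : ∀ f → X f ≡ ⊙ → eliminant f ≢ ⊙ → eliminant f ≡ negS (Y f)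

    vanishes : ∀ {f} → X f ≡ ⊙ → Y f ≡ ⊙ → eliminant f ≡ ⊙
    vanishes {f} Xf≡⊙ Yf≡⊙ with eliminant f ≟ ⊙
    ... | yes Zf≡⊙ = Zf≡⊙
    ... | no Zf≢⊙ = trans (agrees-X f Yf≡⊙ Zf≢⊙) Xf≡⊙

  eliminate : ∀ {X Y e} → Circuit M X → Circuit M Y → ¬ X ≐ Y →
    X e ≡ ⊕ → Y e ≡ ⊕ → Elimination X Y e
  eliminate {X} {Y} {e} cX cY X≢Y Xe Ye
    with C3 M X (negSS Y) cX (C1 M Y cY) (≢-negSS-negSS X≢Y) e Xe (cong negS Ye)
  ... | Z , cZ , plus , minus = record
    { eliminant   = Z
    ; circuit     = cZ
    ; avoids      = avoids
    ; agrees-X    = λ f Yf≡⊙ Zf≢⊙ →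
        eliminant-sign Zf≢⊙ (proj₁ ∘ plus f) (proj₁ ∘ minus f) (cong negS Yf≡⊙)
    ; agrees-negY = λ f Xf≡⊙ Zf≢⊙ →
        eliminant-sign Zf≢⊙ (swap ∘ proj₁ ∘ plus f) (swap ∘ proj₁ ∘ minus f) Xf≡⊙
    }
    where
    avoids : Z e ≡ ⊙
    avoids with Z e in Ze
    ... | ⊙ = refl
    ... | ⊕ = ⊥-elim (proj₂ (plus e Ze) refl)
    ... | ⊖ = ⊥-elim (proj₂ (minus e Ze) refl)

restrict-circuit : ∀ {E} {M : OrientedMatroid E} {Mh : OrientedMatroid (Ext E)} →
  IsExtension M Mh → ∀ {Z} → Circuit Mh Z → Z q ≡ ⊙ → Circuit M (Z ∘ el)
restrict-circuit {M = M} {Mh} ext {Z} cZ Zq≡⊙ = proj₂ (ext (Z ∘ el)) (resp Mh Z≐ext0 cZ)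
  where
  Z≐ext0 : Z ≐ ext0 (Z ∘ el)
  Z≐ext0 q = Zq≡⊙
  Z≐ext0 (el _) = refl

-- pick (v_i) i is the element of the i-th pair that lies in B(v).
pick : ∀ {n} → Bool → Fin n → E2 n
pick false = s
pick true  = t

Bq-outside : ∀ {n} (v : Vec Bool n) {i a} → lookup v i ≡ a → Bq v (el (pick (not a) i)) ≡ false
Bq-outside v {a = false} vᵢ≡false = vᵢ≡false
Bq-outside v {a = true}  vᵢ≡true rewrite vᵢ≡true = refl

SuppIn-outside : ∀ {E} {X : SignedSet E} {B} → SuppIn X B → ∀ {e} → B e ≡ false → X e ≡ ⊙
SuppIn-outside {X = X} X⊆B {e} Be≡false with X e ≟ ⊙
... | yes Xe≡⊙ = Xe≡⊙
... | no Xe≢⊙ with trans (sym (X⊆B e Xe≢⊙)) Be≡false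
...   | ()

module FundamentalCircuit {n} (Mh : OrientedMatroid (Ext (E2 n))) {v X} (FX : IsFundCircuit Mh v X) where

  outside : ∀ {i a} → lookup v i ≡ a → X (el (pick (not a) i)) ≡ ⊙
  outside vᵢ≡a = SuppIn-outside (proj₂ (proj₂ FX)) (Bq-outside v vᵢ≡a)

  outside′ : ∀ {i a} → lookup v i ≡ not a → X (el (pick a i)) ≡ ⊙
  outside′ {i} {a} vᵢ≡¬a =
    subst (λ b → X (el (pick b i)) ≡ ⊙) (not-involutive a) (outside vᵢ≡¬a)

  ppuSign-pick : ∀ {i a} → lookup v i ≡ a →
    ppuSign (X (el (s i))) (X (el (t i))) ≡ negS (X (el (pick a i)))
  ppuSign-pick {i} {false} vᵢ≡a rewrite outside vᵢ≡a = ppuSign-⊙ʳ (X (el (s i)))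
  ppuSign-pick {i} {true}  vᵢ≡a rewrite outside vᵢ≡a = ppuSign-⊙ˡ (X (el (t i)))

module FundamentalCircuits {n} (M : OrientedMatroid (E2 n)) (Mh : OrientedMatroid (Ext (E2 n)))
  (PM : IsPMatroid M) (ext : IsExtension M Mh)
  {O : Vec Bool n → Fin n → Sign} {v w X Y}
  (FX : IsFundCircuit Mh v X) (OX : ∀ i → O v i ≡ ppuSign (X (el (s i))) (X (el (t i))))
  (FY : IsFundCircuit Mh w Y) (OY : ∀ i → O w i ≡ ppuSign (Y (el (s i))) (Y (el (t i))))
  where

  module FX′ = FundamentalCircuit Mh FX
  module FY′ = FundamentalCircuit Mh FY

  Opposed : Set
  Opposed = Σ (Fin n) λ i → lookup v i ≢ lookup w i × Opposite (O v i) (O w i)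

  Unoriented : Set
  Unoriented = ∀ i → lookup v i ≢ lookup w i → O v i ≡ ⊙ × O w i ≡ ⊙

  Ov : ∀ {i a} → lookup v i ≡ a → O v i ≡ negS (X (el (pick a i)))
  Ov vᵢ≡a = trans (OX _) (FX′.ppuSign-pick vᵢ≡a)

  Ow : ∀ {i a} → lookup w i ≡ a → O w i ≡ negS (Y (el (pick a i)))
  Ow wᵢ≡a = trans (OY _) (FY′.ppuSign-pick wᵢ≡a)

  unoriented-if-equal : X ≐ Y → Unoriented
  unoriented-if-equal X≐Y i vᵢ≢wᵢ =
      trans (Ov refl) (cong negS (trans (X≐Y _) (FY′.outside′ (¬-not (vᵢ≢wᵢ ∘ sym)))))
    , trans (Ow refl) (cong negS (trans (sym (X≐Y _)) (FX′.outside′ (¬-not vᵢ≢wᵢ))))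

  opposed-unless-equal : ¬ Opposed → ¬ ¬ X ≐ Y
  opposed-unless-equal ¬opposed X≢Y =
    proj₂ PM (Z ∘ el) (restrict-circuit {M = M} {Mh} ext {Z} circuit avoids) reversing
    where
    open Elimination (eliminate Mh (proj₁ FX) (proj₁ FY) X≢Y (proj₁ (proj₂ FX)) (proj₁ (proj₂ FY)))
      renaming (eliminant to Z)

    reversed-across : ∀ {i} a → lookup v i ≡ a → lookup w i ≡ not a →
      Z (el (pick a i)) ≢ ⊙ → Z (el (pick (not a) i)) ≢ ⊙ →
      Z (el (pick a i)) ≡ negS (Z (el (pick (not a) i)))
    reversed-across {i} a vᵢ≡a wᵢ≡¬a Z≢⊙ Z′≢⊙ =
      reversed-unless-opposite Z≢⊙ Z′≢⊙
        (agrees-X _ (FY′.outside′ wᵢ≡¬a) Z≢⊙)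
        (agrees-negY _ (FX′.outside vᵢ≡a) Z′≢⊙)
        (λ opp → ¬opposed (i , vᵢ≢wᵢ , subst₂ Opposite (sym (Ov vᵢ≡a)) (sym (Ow wᵢ≡¬a)) opp))
      where
      vᵢ≢wᵢ : lookup v i ≢ lookup w i
      vᵢ≢wᵢ vᵢ≡wᵢ = not-¬ refl (trans (sym vᵢ≡a) (trans vᵢ≡wᵢ wᵢ≡¬a))

    reversing : SignReversing (Z ∘ el)
    reversing i Zs≢⊙ Zt≢⊙ with lookup v i in vᵢ | lookup w i in wᵢ
    ... | false | false = ⊥-elim (Zt≢⊙ (vanishes (FX′.outside vᵢ) (FY′.outside wᵢ)))
    ... | true  | true  = ⊥-elim (Zs≢⊙ (vanishes (FX′.outside vᵢ) (FY′.outside wᵢ)))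
    ... | false | true  = reversed-across false vᵢ wᵢ Zs≢⊙ Zt≢⊙
    ... | true  | false = negS-swap (reversed-across true vᵢ wᵢ Zt≢⊙ Zs≢⊙)

  -- X ≐ Y is not decidable, but each coordinate's conclusion is, so the case
  -- split on X ≐ Y can be made under a double negation.
  unoriented-or-opposed : Unoriented ⊎ Opposed
  unoriented-or-opposed
    with any? (λ i → ¬? (lookup v i ≟ᵇ lookup w i) ×-dec opposite? (O v i) (O w i))
  ... | yes opposed = inj₂ opposed
  ... | no ¬opposed = inj₁ λ i vᵢ≢wᵢ →
    decidable-stable ((O v i ≟ ⊙) ×-dec (O w i ≟ ⊙)) λ ¬unoriented →
      opposed-unless-equal ¬opposed (¬unoriented ∘ λ X≐Y → unoriented-if-equal X≐Y i vᵢ≢wᵢ)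

lemma3p3 : (n : ℕ) (M : OrientedMatroid (E2 n)) → IsPMatroid M →
    (Mh : OrientedMatroid (Ext (E2 n))) → IsExtension M Mh →
    (O : Vec Bool n → Fin n → Sign) → IsPPU Mh O →
    PartiallySW O
lemma3p3 n M PM Mh ext O ppu v w _ with ppu v | ppu w
... | X , FX , OX | Y , FY , OY = FundamentalCircuits.unoriented-or-opposed M Mh PM ext FX OX FY OY
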